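{- Let $\beta=\frac{1+\sqrt5}{2}$. For each positive integer $n$ with Zeckendorf expansion $n=\sum_{j\ge0}\epsilon_jF_{j+2}$, let $\delta'(n)=\frac1{\sqrt5}\sum_{j\ge0}\epsilon_j(-\beta)^{ -j-2}$. Then $|\delta'(n)|<\frac{1}{\beta\sqrt5}$ for all $n>0$. Moreover, $\delta'(n)>0$ if $d(n)=0$ or $d(n)=2$, and $\delta'(n)<0$ if $d(n)=1$.
   Context: Fibonacci numbers: $F_0=0,F_1=1,F_n=F_{n-1}+F_{n-2}$. Zeckendorf expansion: $n=\sum_{j\ge0}\epsilon_jF_{j+2}$ uniquely with $\epsilon_j\in\{0,1\}$, finitely many nonzero, $\epsilon_j\epsilon_{j+1}=0$. For $n\ge1$ let $k(n)=\min\{j:\epsilon_j=1\}$ and set $d(n)=0$ if $k(n)=0$, $d(n)=1$ if $k(n)$ is odd, $d(n)=2$ if $k(n)$ is even and $\ge2$. -}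

module Defs where

open import Data.Nat as ℕ using (ℕ; zero; suc)
open import Data.Integer as ℤ using (+_; -[1+_])
open import Data.Rational as ℚ using (ℚ; 0ℚ; 1ℚ)
open import Data.Bool using (Bool; true; false; if_then_else_)
open import Data.List using (List; []; _∷_)
open import Data.Product using (_×_; _,_)
open import Data.Sum using (_⊎_)
open import Data.Empty using (⊥)
open import Data.Unit using (⊤)
open import Relation.Binary.PropositionalEquality using (_≡_; refl)

fib : ℕ → ℕ
fib 0 = 0
fib 1 = 1
fib (suc (suc n)) = fib (suc n) ℕ.+ fib n

-- Zeckendorf digit strings.  A list  ε = ε₀ ∷ ε₁ ∷ …  of bits (position j
-- carries ε_j; positions beyond the list are 0).

NoAdjacentOnes : List Bool → Set
NoAdjacentOnes [] = ⊤
NoAdjacentOnes (_ ∷ []) = ⊤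
NoAdjacentOnes (true ∷ true ∷ _) = ⊥
NoAdjacentOnes (true ∷ false ∷ ε) = NoAdjacentOnes (false ∷ ε)
NoAdjacentOnes (false ∷ e ∷ ε) = NoAdjacentOnes (e ∷ ε)

zeckValueFrom : ℕ → List Bool → ℕ
zeckValueFrom s [] = 0
zeckValueFrom s (e ∷ ε) =
  (if e then fib (s ℕ.+ 2) else 0) ℕ.+ zeckValueFrom (suc s) ε

zeckValue : List Bool → ℕ
zeckValue = zeckValueFrom 0

IsZeckendorf : ℕ → List Bool → Set
IsZeckendorf n ε = NoAdjacentOnes ε × zeckValue ε ≡ n

-- k = min { j : ε_j = 1 }  (returns the length if there is no 1; this case
-- does not occur for expansions of n ≥ 1)
firstOne : List Bool → ℕ
firstOne [] = 0
firstOne (true ∷ ε) = 0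
firstOne (false ∷ ε) = suc (firstOne ε)

-- d from k : d = 0 if k = 0, d = 1 if k odd, d = 2 if k even and ≥ 2
dOfK : ℕ → ℕ
dOfK 0 = 0
dOfK 1 = 1
dOfK (suc (suc k)) with dOfK k
... | 0 = 2
... | m = m

dZ : List Bool → ℕ
dZ ε = dOfK (firstOne ε)

-- The real quadratic field ℚ(√5):  ⟨ a , b ⟩ stands for a + b√5.

record ℚ√5 : Set where
  constructor ⟨_,_⟩
  field
    re : ℚ
    im : ℚ
open ℚ√5 public

infixl 6 _+ᶠ_ _-ᶠ_
infixl 7 _*ᶠ_
infix 4 _<ᶠ_

5ℚ : ℚ
5ℚ = + 5 ℚ./ 1

fromℚ : ℚ → ℚ√5
fromℚ q = ⟨ q , 0ℚ ⟩

0ᶠ 1ᶠ : ℚ√5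
0ᶠ = fromℚ 0ℚ
1ᶠ = fromℚ 1ℚ

_+ᶠ_ : ℚ√5 → ℚ√5 → ℚ√5
⟨ a , b ⟩ +ᶠ ⟨ c , d ⟩ = ⟨ a ℚ.+ c , b ℚ.+ d ⟩

-ᶠ_ : ℚ√5 → ℚ√5
-ᶠ ⟨ a , b ⟩ = ⟨ ℚ.- a , ℚ.- b ⟩

_-ᶠ_ : ℚ√5 → ℚ√5 → ℚ√5
x -ᶠ y = x +ᶠ (-ᶠ y)

_*ᶠ_ : ℚ√5 → ℚ√5 → ℚ√5
⟨ a , b ⟩ *ᶠ ⟨ c , d ⟩ = ⟨ a ℚ.* c ℚ.+ 5ℚ ℚ.* (b ℚ.* d) , a ℚ.* d ℚ.+ b ℚ.* c ⟩

_^ᶠ_ : ℚ√5 → ℕ → ℚ√5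
x ^ᶠ zero = 1ᶠ
x ^ᶠ suc n = x *ᶠ (x ^ᶠ n)

Pos : ℚ√5 → Set
Pos ⟨ a , b ⟩ =
    (0ℚ ℚ.≤ a × 0ℚ ℚ.≤ b × (0ℚ ℚ.< a ⊎ 0ℚ ℚ.< b))
  ⊎ (0ℚ ℚ.< a × b ℚ.< 0ℚ × 5ℚ ℚ.* (b ℚ.* b) ℚ.< a ℚ.* a)
  ⊎ (a ℚ.< 0ℚ × 0ℚ ℚ.< b × a ℚ.* a ℚ.< 5ℚ ℚ.* (b ℚ.* b))

_<ᶠ_ : ℚ√5 → ℚ√5 → Set
x <ᶠ y = Pos (y -ᶠ x)

AbsLt : ℚ√5 → ℚ√5 → Set
AbsLt x c = (-ᶠ c) <ᶠ x × x <ᶠ c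

√5 : ℚ√5
√5 = ⟨ 0ℚ , 1ℚ ⟩

β : ℚ√5
β = ⟨ ℚ.½ , ℚ.½ ⟩

inv√5 : ℚ√5
inv√5 = ⟨ 0ℚ , + 1 ℚ./ 5 ⟩

inv√5-correct : √5 *ᶠ inv√5 ≡ 1ᶠ
inv√5-correct = refl

invNegβ : ℚ√5
invNegβ = ⟨ ℚ.½ , ℚ.- ℚ.½ ⟩

invNegβ-correct : (-ᶠ β) *ᶠ invNegβ ≡ 1ᶠ
invNegβ-correct = refl

invβ√5 : ℚ√5
invβ√5 = ⟨ ℚ.½ , ℚ.- (+ 1 ℚ./ 10) ⟩

invβ√5-correct : (β *ᶠ √5) *ᶠ invβ√5 ≡ 1ᶠ
invβ√5-correct = refl

δsumFrom : ℕ → List Bool → ℚ√5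
δsumFrom s [] = 0ᶠ
δsumFrom s (e ∷ ε) =
  (if e then invNegβ ^ᶠ (s ℕ.+ 2) else 0ᶠ) +ᶠ δsumFrom (suc s) ε

δ′ : List Bool → ℚ√5
δ′ ε = inv√5 *ᶠ δsumFrom 0 ε

{-# OPTIONS --safe #-}
-- Write W(ε) = Σⱼ εⱼ (-β)^(-j-2), so that δ′ = W/√5.  Peeling digits off the front gives
-- W(0ε) = -β⁻¹ W(ε) and W(10ε) = β⁻² + β⁻² W(ε); hence, by induction on the expansion, W lies
-- in (0, β⁻¹) when the first 1 sits at an even position and in (-β⁻², 0) when it sits at an
-- odd one, and both intervals lie inside (-β⁻¹, β⁻¹).
-- All comparisons are exact in ℚ(√5): a positive a + b√5 is classified by the sign of its norm
-- a² - 5b², and this classification survives multiplication by positive elements of nonzero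
-- norm and adding 1, hence adding any positive unit c, as x + c = c (c⁻¹ x + 1).
module Submission where

open import Defs
open import Data.Bool using (Bool; true; false)
open import Data.Empty using (⊥-elim)
open import Data.List using (List; []; _∷_)
open import Data.Product using (_×_; _,_)
open import Data.Sum using (_⊎_; inj₁; inj₂)
open import Relation.Binary.PropositionalEquality
open import Relation.Nullary using (¬_; Dec; yes; no)
open import Relation.Nullary.Decidable using (from-yes; map′)

module ℚ√5-Ring where

  open import Algebra.Solver.Ring.AlmostCommutativeRing using (AlmostCommutativeRing)
  open import Algebra.Structures {A = ℚ√5} _≡_ using (IsCommutativeSemiring)
  open import Algebra.Structures.Biased {A = ℚ√5} _≡_
    using (isCommutativeSemiringˡ; isCommutativeMonoidˡ)
  open import Data.Rational using (_+_; _*_; -_)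
  import Data.Rational.Properties as ℚP
  open import Data.Rational.Solver using (module +-*-Solver)
  open import Relation.Binary.Definitions using (DecidableEquality)
  open +-*-Solver

  +ᶠ-assoc : ∀ x y z → (x +ᶠ y) +ᶠ z ≡ x +ᶠ (y +ᶠ z)
  +ᶠ-assoc ⟨ a , b ⟩ ⟨ c , d ⟩ ⟨ e , f ⟩ = cong₂ ⟨_,_⟩ (ℚP.+-assoc a c e) (ℚP.+-assoc b d f)

  +ᶠ-comm : ∀ x y → x +ᶠ y ≡ y +ᶠ x
  +ᶠ-comm ⟨ a , b ⟩ ⟨ c , d ⟩ = cong₂ ⟨_,_⟩ (ℚP.+-comm a c) (ℚP.+-comm b d)

  +ᶠ-identityˡ : ∀ x → 0ᶠ +ᶠ x ≡ x
  +ᶠ-identityˡ ⟨ a , b ⟩ = cong₂ ⟨_,_⟩ (ℚP.+-identityˡ a) (ℚP.+-identityˡ b)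

  *ᶠ-assoc : ∀ x y z → (x *ᶠ y) *ᶠ z ≡ x *ᶠ (y *ᶠ z)
  *ᶠ-assoc ⟨ a , b ⟩ ⟨ c , d ⟩ ⟨ e , f ⟩ = cong₂ ⟨_,_⟩
    (solve 6 (λ a b c d e f →
         (a :* c :+ con 5ℚ :* (b :* d)) :* e :+ con 5ℚ :* ((a :* d :+ b :* c) :* f)
      := a :* (c :* e :+ con 5ℚ :* (d :* f)) :+ con 5ℚ :* (b :* (c :* f :+ d :* e))) refl a b c d e f)
    (solve 6 (λ a b c d e f →
         (a :* c :+ con 5ℚ :* (b :* d)) :* f :+ (a :* d :+ b :* c) :* e
      := a :* (c :* f :+ d :* e) :+ b :* (c :* e :+ con 5ℚ :* (d :* f))) refl a b c d e f)

  *ᶠ-comm : ∀ x y → x *ᶠ y ≡ y *ᶠ x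
  *ᶠ-comm ⟨ a , b ⟩ ⟨ c , d ⟩ = cong₂ ⟨_,_⟩
    (cong₂ _+_ (ℚP.*-comm a c) (cong (5ℚ *_) (ℚP.*-comm b d)))
    (trans (ℚP.+-comm (a * d) (b * c)) (cong₂ _+_ (ℚP.*-comm b c) (ℚP.*-comm a d)))

  *ᶠ-identityˡ : ∀ x → 1ᶠ *ᶠ x ≡ x
  *ᶠ-identityˡ ⟨ a , b ⟩ = cong₂ ⟨_,_⟩
    (solve 2 (λ a b → con 1ℚ :* a :+ con 5ℚ :* (con 0ℚ :* b) := a) refl a b)
    (solve 2 (λ a b → con 1ℚ :* b :+ con 0ℚ :* a := b) refl a b)
    where open import Data.Rational using (0ℚ; 1ℚ)

  *ᶠ-distribʳ-+ᶠ : ∀ x y z → (y +ᶠ z) *ᶠ x ≡ (y *ᶠ x) +ᶠ (z *ᶠ x)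
  *ᶠ-distribʳ-+ᶠ ⟨ a , b ⟩ ⟨ c , d ⟩ ⟨ e , f ⟩ = cong₂ ⟨_,_⟩
    (solve 6 (λ a b c d e f → (c :+ e) :* a :+ con 5ℚ :* ((d :+ f) :* b)
       := (c :* a :+ con 5ℚ :* (d :* b)) :+ (e :* a :+ con 5ℚ :* (f :* b))) refl a b c d e f)
    (solve 6 (λ a b c d e f → (c :+ e) :* b :+ (d :+ f) :* a
       := (c :* b :+ d :* a) :+ (e :* b :+ f :* a)) refl a b c d e f)

  *ᶠ-zeroˡ : ∀ x → 0ᶠ *ᶠ x ≡ 0ᶠ
  *ᶠ-zeroˡ ⟨ a , b ⟩ = cong₂ ⟨_,_⟩
    (solve 2 (λ a b → con 0ℚ :* a :+ con 5ℚ :* (con 0ℚ :* b) := con 0ℚ) refl a b)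
    (solve 2 (λ a b → con 0ℚ :* b :+ con 0ℚ :* a := con 0ℚ) refl a b)
    where open import Data.Rational using (0ℚ)

  -ᶠ‿distribˡ-*ᶠ : ∀ x y → (-ᶠ x) *ᶠ y ≡ -ᶠ (x *ᶠ y)
  -ᶠ‿distribˡ-*ᶠ ⟨ a , b ⟩ ⟨ c , d ⟩ = cong₂ ⟨_,_⟩
    (solve 4 (λ a b c d → (:- a) :* c :+ con 5ℚ :* ((:- b) :* d)
                       := :- (a :* c :+ con 5ℚ :* (b :* d))) refl a b c d)
    (solve 4 (λ a b c d → (:- a) :* d :+ (:- b) :* c := :- (a :* d :+ b :* c)) refl a b c d)

  -ᶠ‿+ᶠ-comm : ∀ x y → (-ᶠ x) +ᶠ (-ᶠ y) ≡ -ᶠ (x +ᶠ y)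
  -ᶠ‿+ᶠ-comm ⟨ a , b ⟩ ⟨ c , d ⟩ =
    cong₂ ⟨_,_⟩ (sym (ℚP.neg-distrib-+ a c)) (sym (ℚP.neg-distrib-+ b d))

  _≟ᶠ_ : DecidableEquality ℚ√5
  ⟨ a , b ⟩ ≟ᶠ ⟨ c , d ⟩ =
    map′ (λ (a≡c , b≡d) → cong₂ ⟨_,_⟩ a≡c b≡d) (λ { refl → refl , refl })
         (a ℚP.≟ c ×-dec b ℚP.≟ d)
    where open import Relation.Nullary.Decidable using (_×-dec_)

  isCommutativeSemiring : IsCommutativeSemiring _+ᶠ_ _*ᶠ_ 0ᶠ 1ᶠ
  isCommutativeSemiring = isCommutativeSemiringˡ record
    { +-isCommutativeMonoid = isCommutativeMonoidˡ record
        { isSemigroup = record { isMagma = isMagma _+ᶠ_ ; assoc = +ᶠ-assoc }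
        ; identityˡ = +ᶠ-identityˡ ; comm = +ᶠ-comm }
    ; *-isCommutativeMonoid = isCommutativeMonoidˡ record
        { isSemigroup = record { isMagma = isMagma _*ᶠ_ ; assoc = *ᶠ-assoc }
        ; identityˡ = *ᶠ-identityˡ ; comm = *ᶠ-comm }
    ; distribʳ = *ᶠ-distribʳ-+ᶠ
    ; zeroˡ = *ᶠ-zeroˡ
    }

  almostCommutativeRing : AlmostCommutativeRing _ _
  almostCommutativeRing = record
    { isAlmostCommutativeRing = record
      { isCommutativeSemiring = isCommutativeSemiring
      ; -‿cong = cong (λ x → -ᶠ x)
      ; -‿*-distribˡ = -ᶠ‿distribˡ-*ᶠ
      ; -‿+-comm = -ᶠ‿+ᶠ-comm
      }
    }

module Positivity where

  open import Data.Rational as ℚ using (ℚ; 0ℚ; 1ℚ; _+_; _*_; -_; _-_; _<_; _≤_)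
  import Data.Rational.Properties as ℚP
  open import Data.Rational.Solver using (module +-*-Solver)
  open import Relation.Binary.Definitions using (tri<; tri≈; tri>)
  open import Relation.Nullary.Decidable using (_×-dec_; _⊎-dec_)
  open ℚ√5-Ring using (*ᶠ-comm)
  open +-*-Solver

  private
    *-pos : ∀ {p q} → 0ℚ < p → 0ℚ < q → 0ℚ < p * q
    *-pos {p} {q} p>0 q>0 =
      ℚP.positive⁻¹ (p * q) {{ℚP.pos*pos⇒pos p {{ℚ.positive p>0}} q {{ℚ.positive q>0}}}}

    *-pos-neg : ∀ {p q} → 0ℚ < p → q < 0ℚ → p * q < 0ℚ
    *-pos-neg {p} {q} p>0 q<0 =
      ℚP.negative⁻¹ (p * q) {{ℚP.pos*neg⇒neg p {{ℚ.positive p>0}} q {{ℚ.negative q<0}}}}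

    *-neg : ∀ {p q} → p < 0ℚ → q < 0ℚ → 0ℚ < p * q
    *-neg {p} {q} p<0 q<0 =
      ℚP.positive⁻¹ (p * q) {{ℚP.neg*neg⇒pos p {{ℚ.negative p<0}} q {{ℚ.negative q<0}}}}

    *-nonneg : ∀ {p q} → 0ℚ ≤ p → 0ℚ ≤ q → 0ℚ ≤ p * q
    *-nonneg {p} {q} p≥0 q≥0 =
      ℚP.nonNegative⁻¹ (p * q)
        {{ℚP.nonNeg*nonNeg⇒nonNeg p {{ℚ.nonNegative p≥0}} q {{ℚ.nonNegative q≥0}}}}

    square-nonneg : ∀ p → 0ℚ ≤ p * p
    square-nonneg p with ℚP.≤-total 0ℚ p
    ... | inj₁ p≥0 = *-nonneg p≥0 p≥0
    ... | inj₂ p≤0 = ℚP.nonNegative⁻¹ (p * p)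
      {{ℚP.nonPos*nonPos⇒nonPos p {{ℚ.nonPositive p≤0}} p {{ℚ.nonPositive p≤0}}}}

    0<5 : 0ℚ < 5ℚ
    0<5 = from-yes (0ℚ ℚP.<? 5ℚ)

    5-square-nonneg : ∀ p → 0ℚ ≤ 5ℚ * (p * p)
    5-square-nonneg p = *-nonneg (ℚP.<⇒≤ 0<5) (square-nonneg p)

    0<p-q⇒q<p : ∀ {p q} → 0ℚ < p - q → q < p
    0<p-q⇒q<p {p} {q} p-q>0 = subst₂ _<_ (ℚP.+-identityˡ q)
      (solve 2 (λ p q → (p :- q) :+ q := p) refl p q) (ℚP.+-monoˡ-< q p-q>0)

    p-q<0⇒p<q : ∀ {p q} → p - q < 0ℚ → p < q
    p-q<0⇒p<q {p} {q} p-q<0 = 0<p-q⇒q<p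
      (subst (0ℚ <_) (solve 2 (λ p q → :- (p :- q) := q :- p) refl p q) (ℚP.neg-antimono-< p-q<0))

    dominant-sumˡ : ∀ {u v w} → 0ℚ < u → 0ℚ < w → u * u - v * v ≡ w → 0ℚ < u + v
    dominant-sumˡ {u} {v} {w} u>0 w>0 u²-v²≡w with ℚP.≤-total 0ℚ v
    ... | inj₁ v≥0 = ℚP.+-mono-<-≤ u>0 v≥0
    ... | inj₂ v≤0 = ℚP.*-cancelʳ-<-nonNeg (u - v) {{ℚ.nonNegative (ℚP.<⇒≤ u-v>0)}}
        (subst₂ _<_ (sym (ℚP.*-zeroˡ (u - v))) factorise w>0)
      where
      u-v>0 : 0ℚ < u - v
      u-v>0 = ℚP.+-mono-<-≤ u>0 (ℚP.neg-antimono-≤ v≤0)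
      factorise : w ≡ (u + v) * (u - v)
      factorise = trans (sym u²-v²≡w)
        (solve 2 (λ u v → u :* u :- v :* v := (u :+ v) :* (u :- v)) refl u v)

  norm : ℚ√5 → ℚ
  norm x = re x * re x - 5ℚ * (im x * im x)

  norm-* : ∀ x y → norm (x *ᶠ y) ≡ norm x * norm y
  norm-* ⟨ p , q ⟩ ⟨ a , b ⟩ = solve 4 (λ p q a b →
       (p :* a :+ con 5ℚ :* (q :* b)) :* (p :* a :+ con 5ℚ :* (q :* b))
         :- con 5ℚ :* ((p :* b :+ q :* a) :* (p :* b :+ q :* a))
    := (p :* p :- con 5ℚ :* (q :* q)) :* (a :* a :- con 5ℚ :* (b :* b))) refl p q a b

  -- The sign of the norm is the sign of the conjugate a - b√5.  Pos⁰ is in fact empty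
  -- (√5 is irrational), but keeping it is cheaper than proving that.
  Pos⁺ Pos⁻ Pos⁰ : ℚ√5 → Set
  Pos⁺ x = 0ℚ < re x × 0ℚ < norm x
  Pos⁻ x = 0ℚ < im x × norm x < 0ℚ
  Pos⁰ x = 0ℚ < re x × 0ℚ < im x × norm x ≡ 0ℚ

  Positive± Positive : ℚ√5 → Set
  Positive± x = Pos⁺ x ⊎ Pos⁻ x
  Positive x = Positive± x ⊎ Pos⁰ x

  Positive±? : ∀ x → Dec (Positive± x)
  Positive±? x = ((0ℚ ℚP.<? re x) ×-dec (0ℚ ℚP.<? norm x))
           ⊎-dec ((0ℚ ℚP.<? im x) ×-dec (norm x ℚP.<? 0ℚ))

  Positive-quadrant : ∀ {a b} → 0ℚ < a → 0ℚ < b → Positive ⟨ a , b ⟩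
  Positive-quadrant {a} {b} a>0 b>0 with ℚP.<-cmp 0ℚ (norm ⟨ a , b ⟩)
  ... | tri< N>0 _ _ = inj₁ (inj₁ (a>0 , N>0))
  ... | tri≈ _ N≡0 _ = inj₂ (a>0 , b>0 , sym N≡0)
  ... | tri> _ _ N<0 = inj₁ (inj₂ (b>0 , N<0))

  Positive⇒Pos : ∀ x → Positive x → Pos x
  Positive⇒Pos ⟨ a , b ⟩ (inj₁ (inj₁ (a>0 , N>0))) with ℚP.<-cmp 0ℚ b
  ... | tri< b>0 _ _ = inj₁ (ℚP.<⇒≤ a>0 , ℚP.<⇒≤ b>0 , inj₁ a>0)
  ... | tri≈ _ refl _ = inj₁ (ℚP.<⇒≤ a>0 , ℚP.≤-refl , inj₁ a>0)
  ... | tri> _ _ b<0 = inj₂ (inj₁ (a>0 , b<0 , 0<p-q⇒q<p N>0))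
  Positive⇒Pos ⟨ a , b ⟩ (inj₁ (inj₂ (b>0 , N<0))) with ℚP.<-cmp 0ℚ a
  ... | tri< a>0 _ _ = inj₁ (ℚP.<⇒≤ a>0 , ℚP.<⇒≤ b>0 , inj₂ b>0)
  ... | tri≈ _ refl _ = inj₁ (ℚP.≤-refl , ℚP.<⇒≤ b>0 , inj₂ b>0)
  ... | tri> _ _ a<0 = inj₂ (inj₂ (a<0 , b>0 , p-q<0⇒p<q N<0))
  Positive⇒Pos ⟨ a , b ⟩ (inj₂ (a>0 , b>0 , _)) = inj₁ (ℚP.<⇒≤ a>0 , ℚP.<⇒≤ b>0 , inj₁ a>0)

  private
    square-pos : ∀ {p} → 0ℚ < p → 0ℚ < p * p
    square-pos p>0 = *-pos p>0 p>0

    -- Each component of (p + q√5)(a + b√5) is a sum u + v, and u² - v² is one of these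
    -- combinations of the norms of the factors.
    [pa]²-[5qb]² : ∀ p q a b → (p * a) * (p * a) - (5ℚ * (q * b)) * (5ℚ * (q * b))
                             ≡ p * p * norm ⟨ a , b ⟩ + 5ℚ * (b * b) * norm ⟨ p , q ⟩
    [pa]²-[5qb]² = solve 4 (λ p q a b →
         (p :* a) :* (p :* a) :- (con 5ℚ :* (q :* b)) :* (con 5ℚ :* (q :* b))
      := p :* p :* (a :* a :- con 5ℚ :* (b :* b))
           :+ con 5ℚ :* (b :* b) :* (p :* p :- con 5ℚ :* (q :* q))) refl

    [5qb]²-[pa]² : ∀ p q a b → (5ℚ * (q * b)) * (5ℚ * (q * b)) - (p * a) * (p * a)
                             ≡ 5ℚ * (q * q) * - norm ⟨ a , b ⟩ + a * a * - norm ⟨ p , q ⟩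
    [5qb]²-[pa]² = solve 4 (λ p q a b →
         (con 5ℚ :* (q :* b)) :* (con 5ℚ :* (q :* b)) :- (p :* a) :* (p :* a)
      := con 5ℚ :* (q :* q) :* (:- (a :* a :- con 5ℚ :* (b :* b)))
           :+ a :* a :* (:- (p :* p :- con 5ℚ :* (q :* q)))) refl

    [pb]²-[qa]² : ∀ p q a b → (p * b) * (p * b) - (q * a) * (q * a)
                            ≡ b * b * norm ⟨ p , q ⟩ + q * q * - norm ⟨ a , b ⟩
    [pb]²-[qa]² = solve 4 (λ p q a b →
         (p :* b) :* (p :* b) :- (q :* a) :* (q :* a)
      := b :* b :* (p :* p :- con 5ℚ :* (q :* q))
           :+ q :* q :* (:- (a :* a :- con 5ℚ :* (b :* b)))) refl

    [qa]²-[pb]² : ∀ p q a b → (q * a) * (q * a) - (p * b) * (p * b)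
                            ≡ q * q * norm ⟨ a , b ⟩ + b * b * - norm ⟨ p , q ⟩
    [qa]²-[pb]² = solve 4 (λ p q a b →
         (q :* a) :* (q :* a) :- (p :* b) :* (p :* b)
      := q :* q :* (a :* a :- con 5ℚ :* (b :* b))
           :+ b :* b :* (:- (p :* p :- con 5ℚ :* (q :* q)))) refl

    dominant-sumʳ : ∀ {u} v {w} → 0ℚ < u → 0ℚ < w → u * u - v * v ≡ w → 0ℚ < v + u
    dominant-sumʳ {u} v u>0 w>0 u²-v²≡w =
      subst (0ℚ <_) (ℚP.+-comm u v) (dominant-sumˡ u>0 w>0 u²-v²≡w)

  Pos⁺-*-Pos⁺ : ∀ {x y} → Pos⁺ x → Pos⁺ y → Pos⁺ (x *ᶠ y)
  Pos⁺-*-Pos⁺ {x@(⟨ p , q ⟩)} {y@(⟨ a , b ⟩)} (p>0 , Nx>0) (a>0 , Ny>0) =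
      dominant-sumˡ (*-pos p>0 a>0)
        (ℚP.+-mono-<-≤ (*-pos (square-pos p>0) Ny>0)
                       (*-nonneg (5-square-nonneg b) (ℚP.<⇒≤ Nx>0)))
        ([pa]²-[5qb]² p q a b)
    , subst (0ℚ <_) (sym (norm-* x y)) (*-pos Nx>0 Ny>0)

  Pos⁺-*-Pos⁻ : ∀ {x y} → Pos⁺ x → Pos⁻ y → Pos⁻ (x *ᶠ y)
  Pos⁺-*-Pos⁻ {x@(⟨ p , q ⟩)} {y@(⟨ a , b ⟩)} (p>0 , Nx>0) (b>0 , Ny<0) =
      dominant-sumˡ (*-pos p>0 b>0)
        (ℚP.+-mono-<-≤ (*-pos (square-pos b>0) Nx>0)
                       (*-nonneg (square-nonneg q) (ℚP.<⇒≤ (ℚP.neg-antimono-< Ny<0))))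
        ([pb]²-[qa]² p q a b)
    , subst (_< 0ℚ) (sym (norm-* x y)) (*-pos-neg Nx>0 Ny<0)

  Pos⁻-*-Pos⁻ : ∀ {x y} → Pos⁻ x → Pos⁻ y → Pos⁺ (x *ᶠ y)
  Pos⁻-*-Pos⁻ {x@(⟨ p , q ⟩)} {y@(⟨ a , b ⟩)} (q>0 , Nx<0) (b>0 , Ny<0) =
      dominant-sumʳ (p * a) (*-pos 0<5 (*-pos q>0 b>0))
        (ℚP.+-mono-<-≤ (*-pos (*-pos 0<5 (square-pos q>0)) (ℚP.neg-antimono-< Ny<0))
                       (*-nonneg (square-nonneg a) (ℚP.<⇒≤ (ℚP.neg-antimono-< Nx<0))))
        ([5qb]²-[pa]² p q a b)
    , subst (0ℚ <_) (sym (norm-* x y)) (*-neg Nx<0 Ny<0)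

  Positive±-*-Pos⁰ : ∀ {x y} → Positive± x → Pos⁰ y → Pos⁰ (x *ᶠ y)
  Positive±-*-Pos⁰ {x@(⟨ p , q ⟩)} {y@(⟨ a , b ⟩)} x± (a>0 , b>0 , Ny≡0) =
    let (re>0 , im>0) = components x± in re>0 , im>0 , Nxy≡0
    where
    Ny≥0 : 0ℚ ≤ norm y
    Ny≥0 = ℚP.≤-reflexive (sym Ny≡0)
    -Ny≥0 : 0ℚ ≤ - norm y
    -Ny≥0 = ℚP.≤-reflexive (cong -_ (sym Ny≡0))
    Nxy≡0 : norm (x *ᶠ y) ≡ 0ℚ
    Nxy≡0 = trans (norm-* x y) (trans (cong (norm x *_) Ny≡0) (ℚP.*-zeroʳ (norm x)))
    components : Positive± x → 0ℚ < re (x *ᶠ y) × 0ℚ < im (x *ᶠ y)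
    components (inj₁ (p>0 , Nx>0)) =
        dominant-sumˡ (*-pos p>0 a>0)
          (ℚP.+-mono-≤-< (*-nonneg (square-nonneg p) Ny≥0)
                         (*-pos (*-pos 0<5 (square-pos b>0)) Nx>0))
          ([pa]²-[5qb]² p q a b)
      , dominant-sumˡ (*-pos p>0 b>0)
          (ℚP.+-mono-<-≤ (*-pos (square-pos b>0) Nx>0) (*-nonneg (square-nonneg q) -Ny≥0))
          ([pb]²-[qa]² p q a b)
    components (inj₂ (q>0 , Nx<0)) =
        dominant-sumʳ (p * a) (*-pos 0<5 (*-pos q>0 b>0))
          (ℚP.+-mono-≤-< (*-nonneg (5-square-nonneg q) -Ny≥0)
                         (*-pos (square-pos a>0) (ℚP.neg-antimono-< Nx<0)))
          ([5qb]²-[pa]² p q a b)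
      , dominant-sumʳ (p * b) (*-pos q>0 a>0)
          (ℚP.+-mono-≤-< (*-nonneg (square-nonneg q) Ny≥0)
                         (*-pos (square-pos b>0) (ℚP.neg-antimono-< Nx<0)))
          ([qa]²-[pb]² p q a b)

  *-preserves-Positive± : ∀ {x y} → Positive± x → Positive± y → Positive± (x *ᶠ y)
  *-preserves-Positive± {x} {y} (inj₁ x⁺) (inj₁ y⁺) = inj₁ (Pos⁺-*-Pos⁺ {x} {y} x⁺ y⁺)
  *-preserves-Positive± {x} {y} (inj₁ x⁺) (inj₂ y⁻) = inj₂ (Pos⁺-*-Pos⁻ {x} {y} x⁺ y⁻)
  *-preserves-Positive± {x} {y} (inj₂ x⁻) (inj₁ y⁺) =
    inj₂ (subst Pos⁻ (*ᶠ-comm y x) (Pos⁺-*-Pos⁻ {y} {x} y⁺ x⁻))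
  *-preserves-Positive± {x} {y} (inj₂ x⁻) (inj₂ y⁻) = inj₁ (Pos⁻-*-Pos⁻ {x} {y} x⁻ y⁻)

  *-preserves-Positive : ∀ {x y} → Positive± x → Positive y → Positive (x *ᶠ y)
  *-preserves-Positive {x} {y} x± (inj₁ y±) = inj₁ (*-preserves-Positive± {x} {y} x± y±)
  *-preserves-Positive {x} {y} x± (inj₂ y⁰) = inj₂ (Positive±-*-Pos⁰ {x} {y} x± y⁰)

  Positive-+1 : ∀ {x} → Positive x → Positive (x +ᶠ 1ᶠ)
  Positive-+1 {⟨ a , b ⟩} x⁺ =
    subst (λ b′ → Positive ⟨ a + 1ℚ , b′ ⟩) (sym (ℚP.+-identityʳ b)) (shifted x⁺)
    where
    a+1>0 : 0ℚ < a → 0ℚ < a + 1ℚ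
    a+1>0 a>0 = ℚP.+-mono-< a>0 (from-yes (0ℚ ℚP.<? 1ℚ))
    a≤a+1 : a ≤ a + 1ℚ
    a≤a+1 = subst (_≤ a + 1ℚ) (ℚP.+-identityʳ a) (ℚP.+-monoʳ-≤ a (from-yes (0ℚ ℚP.≤? 1ℚ)))
    norm-shift : norm ⟨ a + 1ℚ , b ⟩ ≡ norm ⟨ a , b ⟩ + ((a + 1ℚ) + a)
    norm-shift = solve 2 (λ a b →
         (a :+ con 1ℚ) :* (a :+ con 1ℚ) :- con 5ℚ :* (b :* b)
      := (a :* a :- con 5ℚ :* (b :* b)) :+ ((a :+ con 1ℚ) :+ a)) refl a b
    shifted : Positive ⟨ a , b ⟩ → Positive ⟨ a + 1ℚ , b ⟩
    shifted (inj₁ (inj₁ (a>0 , N>0))) = inj₁ (inj₁ (a+1>0 a>0 ,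
      subst (0ℚ <_) (sym norm-shift) (ℚP.+-mono-< N>0 (ℚP.+-mono-< (a+1>0 a>0) a>0))))
    shifted (inj₁ (inj₂ (b>0 , N<0))) with 0ℚ ℚP.<? a + 1ℚ
    ... | yes a+1>0′ = Positive-quadrant a+1>0′ b>0
    ... | no a+1≯0 = inj₁ (inj₂ (b>0 ,
      subst (_< 0ℚ) (sym norm-shift)
        (ℚP.+-mono-<-≤ N<0 (ℚP.+-mono-≤ a+1≤0 (ℚP.≤-trans a≤a+1 a+1≤0)))))
      where
      a+1≤0 : a + 1ℚ ≤ 0ℚ
      a+1≤0 = ℚP.≮⇒≥ a+1≯0
    shifted (inj₂ (a>0 , b>0 , _)) = Positive-quadrant (a+1>0 a>0) b>0

open import Algebra.Structures {A = ℚ√5} _≡_ using (module IsCommutativeSemiring)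
import Algebra.Solver.Ring.Simple as RingSolver
open import Data.Nat using (ℕ; zero; suc; _+_; _<_)
open import Data.Unit using (tt)
open import Relation.Nullary.Decidable using (True; toWitness)
open ℚ√5-Ring
  using (+ᶠ-identityˡ; *ᶠ-identityˡ; isCommutativeSemiring; almostCommutativeRing; _≟ᶠ_)
open IsCommutativeSemiring isCommutativeSemiring using (distribˡ)
open RingSolver almostCommutativeRing _≟ᶠ_ using (solve; _:=_; con; _:+_; _:*_; _:-_; :-_)
open Positivity using ( Positive±; Positive; Positive±?; *-preserves-Positive±
                       ; *-preserves-Positive; Positive-+1; Positive⇒Pos )
open ≡-Reasoning

positive± : (c : ℚ√5) → {True (Positive±? c)} → Positive± c
positive± c {c±} = toWitness c±

+-preserves-Positive : ∀ {c c⁻¹ x} → Positive± c → Positive± c⁻¹ → c *ᶠ c⁻¹ ≡ 1ᶠ →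
                       Positive x → Positive (x +ᶠ c)
+-preserves-Positive {c} {c⁻¹} {x} c± c⁻¹± cc⁻¹≡1 x⁺ =
  subst Positive (begin
      c *ᶠ (c⁻¹ *ᶠ x +ᶠ 1ᶠ)
        ≡⟨ solve 3 (λ c c⁻¹ x → c :* (c⁻¹ :* x :+ con 1ᶠ) := (c :* c⁻¹) :* x :+ c) refl c c⁻¹ x ⟩
      (c *ᶠ c⁻¹) *ᶠ x +ᶠ c
        ≡⟨ cong (λ u → u *ᶠ x +ᶠ c) cc⁻¹≡1 ⟩
      1ᶠ *ᶠ x +ᶠ c
        ≡⟨ cong (_+ᶠ c) (*ᶠ-identityˡ x) ⟩
      x +ᶠ c ∎)
    (*-preserves-Positive c± (Positive-+1 (*-preserves-Positive c⁻¹± x⁺)))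

^-preserves-Positive± : ∀ {x} k → Positive± x → Positive± (x ^ᶠ k)
^-preserves-Positive± zero _ = positive± 1ᶠ
^-preserves-Positive± (suc k) x± = *-preserves-Positive± x± (^-preserves-Positive± k x±)

β⁻¹ β⁻² β⁻³ : ℚ√5
β⁻¹ = -ᶠ invNegβ
β⁻² = β⁻¹ ^ᶠ 2
β⁻³ = β⁻¹ ^ᶠ 3

β⁻¹^k*β^k≡1 : ∀ k → β⁻¹ ^ᶠ k *ᶠ β ^ᶠ k ≡ 1ᶠ
β⁻¹^k*β^k≡1 zero = refl
β⁻¹^k*β^k≡1 (suc k) = begin
  (β⁻¹ *ᶠ β⁻¹ ^ᶠ k) *ᶠ (β *ᶠ β ^ᶠ k)
    ≡⟨ solve 2 (λ u v → (con β⁻¹ :* u) :* (con β :* v) := u :* v) refl (β⁻¹ ^ᶠ k) (β ^ᶠ k) ⟩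
  β⁻¹ ^ᶠ k *ᶠ β ^ᶠ k
    ≡⟨ β⁻¹^k*β^k≡1 k ⟩
  1ᶠ ∎

Positive-+β⁻ : ∀ k {x} → Positive x → Positive (x +ᶠ β⁻¹ ^ᶠ k)
Positive-+β⁻ k = +-preserves-Positive
  (^-preserves-Positive± k (positive± β⁻¹)) (^-preserves-Positive± k (positive± β)) (β⁻¹^k*β^k≡1 k)

EvenRange OddRange : ℚ√5 → Set
EvenRange W = Positive W × Positive (β⁻¹ -ᶠ W)
OddRange W = Positive (-ᶠ W) × Positive (W +ᶠ β⁻²)

EvenRange-β⁻² : EvenRange β⁻²
EvenRange-β⁻² = inj₁ (positive± β⁻²) , inj₁ (positive± (β⁻¹ -ᶠ β⁻²))

EvenRange-prepend0 : ∀ {W} → EvenRange W → OddRange (invNegβ *ᶠ W)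
EvenRange-prepend0 {W} (W>0 , W<β⁻¹) =
    subst Positive (solve 1 (λ W → con β⁻¹ :* W := :- (con invNegβ :* W)) refl W)
      (*-preserves-Positive (positive± β⁻¹) W>0)
  , subst Positive (solve 1 (λ W → con β⁻¹ :* (con β⁻¹ :- W) := con invNegβ :* W :+ con β⁻²) refl W)
      (*-preserves-Positive (positive± β⁻¹) W<β⁻¹)

OddRange-prepend0 : ∀ {W} → OddRange W → EvenRange (invNegβ *ᶠ W)
OddRange-prepend0 {W} (W<0 , W>-β⁻²) =
    subst Positive (solve 1 (λ W → con β⁻¹ :* (:- W) := con invNegβ :* W) refl W)
      (*-preserves-Positive (positive± β⁻¹) W<0)
  , subst Positive
      (solve 1 (λ W → con β⁻¹ :* (W :+ con β⁻²) :+ con β⁻² := con β⁻¹ :- con invNegβ :* W) refl W)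
      (Positive-+β⁻ 2 (*-preserves-Positive (positive± β⁻¹) W>-β⁻²))

EvenRange-prepend10 : ∀ {W} → EvenRange W → EvenRange (β⁻² +ᶠ β⁻² *ᶠ W)
EvenRange-prepend10 {W} (W>0 , W<β⁻¹) =
    subst Positive (solve 1 (λ W → con β⁻² :* (W :+ con 1ᶠ) := con β⁻² :+ con β⁻² :* W) refl W)
      (*-preserves-Positive (positive± β⁻²) (Positive-+1 W>0))
  , subst Positive
      (solve 1 (λ W → con β⁻² :* (con β⁻¹ :- W) := con β⁻¹ :- (con β⁻² :+ con β⁻² :* W)) refl W)
      (*-preserves-Positive (positive± β⁻²) W<β⁻¹)

OddRange-prepend10 : ∀ {W} → OddRange W → EvenRange (β⁻² +ᶠ β⁻² *ᶠ W)
OddRange-prepend10 {W} (W<0 , W>-β⁻²) =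
    subst Positive
      (solve 1 (λ W → con β⁻² :* ((W :+ con β⁻²) :+ con β⁻¹) := con β⁻² :+ con β⁻² :* W) refl W)
      (*-preserves-Positive (positive± β⁻²) (Positive-+β⁻ 1 W>-β⁻²))
  , subst Positive
      (solve 1 (λ W → con β⁻² :* (:- W) :+ con β⁻³ := con β⁻¹ :- (con β⁻² :+ con β⁻² :* W)) refl W)
      (Positive-+β⁻ 3 (*-preserves-Positive (positive± β⁻²) W<0))

Pos-inv√5* : ∀ {z} w → Positive w → inv√5 *ᶠ w ≡ z → Pos z
Pos-inv√5* {z} w w>0 eq =
  Positive⇒Pos z (subst Positive eq (*-preserves-Positive (positive± inv√5) w>0))

EvenRange⇒bounds : ∀ {W} → EvenRange W → AbsLt (inv√5 *ᶠ W) invβ√5 × 0ᶠ <ᶠ inv√5 *ᶠ W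
EvenRange⇒bounds {W} (W>0 , W<β⁻¹) =
    ( Pos-inv√5* (W +ᶠ β⁻¹) (Positive-+β⁻ 1 W>0)
        (solve 1 (λ W → con inv√5 :* (W :+ con β⁻¹) := con inv√5 :* W :- (:- con invβ√5))
                 refl W)
    , Pos-inv√5* (β⁻¹ -ᶠ W) W<β⁻¹
        (solve 1 (λ W → con inv√5 :* (con β⁻¹ :- W) := con invβ√5 :- con inv√5 :* W) refl W) )
  , Pos-inv√5* W W>0
      (solve 1 (λ W → con inv√5 :* W := con inv√5 :* W :- con 0ᶠ) refl W)

OddRange⇒bounds : ∀ {W} → OddRange W → AbsLt (inv√5 *ᶠ W) invβ√5 × inv√5 *ᶠ W <ᶠ 0ᶠ
OddRange⇒bounds {W} (W<0 , W>-β⁻²) =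
    ( Pos-inv√5* ((W +ᶠ β⁻²) +ᶠ β⁻³) (Positive-+β⁻ 3 W>-β⁻²)
        (solve 1 (λ W → con inv√5 :* ((W :+ con β⁻²) :+ con β⁻³) := con inv√5 :* W :- (:- con invβ√5))
                 refl W)
    , Pos-inv√5* ((-ᶠ W) +ᶠ β⁻¹) (Positive-+β⁻ 1 W<0)
        (solve 1 (λ W → con inv√5 :* ((:- W) :+ con β⁻¹) := con invβ√5 :- con inv√5 :* W)
                 refl W) )
  , Pos-inv√5* (-ᶠ W) W<0
      (solve 1 (λ W → con inv√5 :* (:- W) := con 0ᶠ :- con inv√5 :* W) refl W)

δsumFrom-suc : ∀ s ε → δsumFrom (suc s) ε ≡ invNegβ *ᶠ δsumFrom s ε
δsumFrom-suc s [] = refl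
δsumFrom-suc s (true ∷ ε) = trans (cong (invNegβ ^ᶠ (suc s + 2) +ᶠ_) (δsumFrom-suc (suc s) ε))
  (sym (distribˡ invNegβ (invNegβ ^ᶠ (s + 2)) (δsumFrom (suc s) ε)))
δsumFrom-suc s (false ∷ ε) = trans (cong (0ᶠ +ᶠ_) (δsumFrom-suc (suc s) ε))
  (sym (distribˡ invNegβ 0ᶠ (δsumFrom (suc s) ε)))

δsum : List Bool → ℚ√5
δsum = δsumFrom 0

δsum-false : ∀ ε → δsum (false ∷ ε) ≡ invNegβ *ᶠ δsum ε
δsum-false ε = trans (+ᶠ-identityˡ _) (δsumFrom-suc 0 ε)

δsum-true-false : ∀ ε → δsum (true ∷ false ∷ ε) ≡ β⁻² +ᶠ β⁻² *ᶠ δsum ε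
δsum-true-false ε = begin
  β⁻² +ᶠ δsumFrom 1 (false ∷ ε)
    ≡⟨ cong (β⁻² +ᶠ_) (δsumFrom-suc 0 (false ∷ ε)) ⟩
  β⁻² +ᶠ invNegβ *ᶠ δsum (false ∷ ε)
    ≡⟨ cong (λ W → β⁻² +ᶠ invNegβ *ᶠ W) (δsum-false ε) ⟩
  β⁻² +ᶠ invNegβ *ᶠ (invNegβ *ᶠ δsum ε)
    ≡⟨ solve 1 (λ W → con β⁻² :+ con invNegβ :* (con invNegβ :* W) := con β⁻² :+ con β⁻² :* W)
               refl (δsum ε) ⟩
  β⁻² +ᶠ β⁻² *ᶠ δsum ε ∎

data HasOne : List Bool → Set where
  here : ∀ {ε} → HasOne (true ∷ ε)
  there : ∀ {ε} → HasOne ε → HasOne (false ∷ ε)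

hasOne? : ∀ ε → Dec (HasOne ε)
hasOne? [] = no λ ()
hasOne? (true ∷ ε) = yes here
hasOne? (false ∷ ε) = map′ there (λ { (there h) → h }) (hasOne? ε)

δsumFrom-noOne : ∀ s {ε} → ¬ HasOne ε → δsumFrom s ε ≡ 0ᶠ
δsumFrom-noOne s {[]} _ = refl
δsumFrom-noOne s {true ∷ ε} ¬h = ⊥-elim (¬h here)
δsumFrom-noOne s {false ∷ ε} ¬h = cong (0ᶠ +ᶠ_) (δsumFrom-noOne (suc s) (λ h → ¬h (there h)))

0<zeckValueFrom⇒HasOne : ∀ s ε → 0 < zeckValueFrom s ε → HasOne ε
0<zeckValueFrom⇒HasOne s (true ∷ ε) _ = here
0<zeckValueFrom⇒HasOne s (false ∷ ε) v>0 = there (0<zeckValueFrom⇒HasOne (suc s) ε v>0)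

NoAdjacentOnes-tail : ∀ e ε → NoAdjacentOnes (e ∷ ε) → NoAdjacentOnes ε
NoAdjacentOnes-tail _ [] _ = tt
NoAdjacentOnes-tail false (_ ∷ _) noAdj = noAdj
NoAdjacentOnes-tail true (false ∷ _) noAdj = noAdj

nextD : ℕ → ℕ
nextD 1 = 2
nextD _ = 1

dOfK-suc : ∀ k → dOfK (suc k) ≡ nextD (dOfK k)
dOfK-suc 0 = refl
dOfK-suc 1 = refl
dOfK-suc (suc (suc k)) rewrite dOfK-suc k with dOfK k
... | zero = refl
... | suc zero = refl
... | suc (suc d) = refl

Range : ℕ → ℚ√5 → Set
Range 1 = OddRange
Range _ = EvenRange

Range-prepend0 : ∀ d {W} → Range d W → Range (nextD d) (invNegβ *ᶠ W)
Range-prepend0 0 = EvenRange-prepend0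
Range-prepend0 1 = OddRange-prepend0
Range-prepend0 (suc (suc _)) = EvenRange-prepend0

Range-prepend10 : ∀ d {W} → Range d W → EvenRange (β⁻² +ᶠ β⁻² *ᶠ W)
Range-prepend10 0 = EvenRange-prepend10
Range-prepend10 1 = OddRange-prepend10
Range-prepend10 (suc (suc _)) = EvenRange-prepend10

Range-δsum : ∀ {ε} → NoAdjacentOnes ε → HasOne ε → Range (dZ ε) (δsum ε)
Range-δsum {false ∷ ε} noAdj (there h) =
  subst₂ Range (sym (dOfK-suc (firstOne ε))) (sym (δsum-false ε))
    (Range-prepend0 (dZ ε) (Range-δsum (NoAdjacentOnes-tail false ε noAdj) h))
Range-δsum {true ∷ []} _ here = EvenRange-β⁻²
Range-δsum {true ∷ false ∷ ε} noAdj here with hasOne? ε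
... | yes h = subst EvenRange (sym (δsum-true-false ε))
  (Range-prepend10 (dZ ε) (Range-δsum (NoAdjacentOnes-tail false ε noAdj) h))
... | no ¬h = subst EvenRange
  (sym (trans (δsum-true-false ε) (cong (λ W → β⁻² +ᶠ β⁻² *ᶠ W) (δsumFrom-noOne 0 ¬h))))
  EvenRange-β⁻²

Range⇒bounds : ∀ d {W} → Range d W →
    AbsLt (inv√5 *ᶠ W) invβ√5
  × (d ≡ 0 → 0ᶠ <ᶠ inv√5 *ᶠ W)
  × (d ≡ 2 → 0ᶠ <ᶠ inv√5 *ᶠ W)
  × (d ≡ 1 → inv√5 *ᶠ W <ᶠ 0ᶠ)
Range⇒bounds 0 r =
  let (|δ′|<c , δ′>0) = EvenRange⇒bounds r in |δ′|<c , (λ _ → δ′>0) , (λ ()) , (λ ())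
Range⇒bounds 1 r =
  let (|δ′|<c , δ′<0) = OddRange⇒bounds r in |δ′|<c , (λ ()) , (λ ()) , (λ _ → δ′<0)
Range⇒bounds (suc (suc _)) r =
  let (|δ′|<c , δ′>0) = EvenRange⇒bounds r in |δ′|<c , (λ ()) , (λ _ → δ′>0) , (λ ())

proposition2 : (n : ℕ) → 0 < n → (ε : List Bool) → IsZeckendorf n ε →
    AbsLt (δ′ ε) invβ√5
    × (dZ ε ≡ 0 → 0ᶠ <ᶠ δ′ ε)
    × (dZ ε ≡ 2 → 0ᶠ <ᶠ δ′ ε)
    × (dZ ε ≡ 1 → δ′ ε <ᶠ 0ᶠ)
proposition2 n n>0 ε (noAdj , value≡n) = Range⇒bounds (dZ ε) (Range-δsum noAdj hasOne)
  where
  hasOne : HasOne ε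
  hasOne = 0<zeckValueFrom⇒HasOne 0 ε (subst (0 <_) (sym value≡n) n>0)
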